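{- Let $G=(V,E)$ be a connected graph with unit edge lengths and shortest-path distance $d$, and let $f:V\to\mathbb{Z}$. For any two nodes $u,v\in V$, $d(u,v)\le\varphi(u)+\varphi(v)$, where $\varphi(x)=|\{w\in V\mid d(w,x)\neq f(w)\}|$.
   Context: $\varphi$ is the implied-error function: $\varphi(x)$ counts the vertices whose prediction $f(w)$ differs from their distance to $x$. -}

module Defs where

open import Data.Nat using (ℕ; zero; suc; _≤_)
open import Data.Integer using (ℤ; +_)
import Data.Integer.Properties as ℤP
open import Data.Fin using (Fin)
open import Data.List using (List; length; filter; allFin)
open import Data.Product using (_×_; ∃)
open import Relation.Nullary using (¬_; ¬?)
open import Relation.Binary.PropositionalEquality using (_≡_)

record Graph (n : ℕ) : Set₁ where
  field
    Adj       : Fin n → Fin n → Set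
    adj-sym   : ∀ {u v} → Adj u v → Adj v u
    adj-irrefl : ∀ {u} → ¬ Adj u u
open Graph public

data Walk {n : ℕ} (G : Graph n) : Fin n → Fin n → ℕ → Set where
  here : ∀ {u} → Walk G u u zero
  step : ∀ {u w v k} → Adj G u w → Walk G w v k → Walk G u v (suc k)

Connected : ∀ {n} → Graph n → Set
Connected {n} G = ∀ (u v : Fin n) → ∃ λ k → Walk G u v k

IsShortestPathDistance : ∀ {n} → Graph n → (Fin n → Fin n → ℕ) → Set
IsShortestPathDistance {n} G d =
  ∀ (u v : Fin n) → Walk G u v (d u v) × (∀ k → Walk G u v k → d u v ≤ k)

φ : ∀ {n} → (Fin n → Fin n → ℕ) → (Fin n → ℤ) → Fin n → ℕ
φ {n} d f x = length (filter (λ w → ¬? ((+ d w x) ℤP.≟ f w)) (allFin n))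

{-# OPTIONS --safe #-}
-- Along a shortest path u = x₀, x₁, …, x_k = v the vertex xᵢ is at distance i from u and k − i
-- from v. A vertex predicting correctly for both u and v would have i = f(xᵢ) = k − i, so every
-- xᵢ except possibly the midpoint is a misfit for u or for v. These are at least k distinct
-- vertices, each counted in φ(u) or in φ(v).
module Submission where

open import Defs
open import Data.Nat using (ℕ; zero; suc; _≤_; _<_; _+_; _∸_; z≤n; s≤s; _≤?_; _<?_)
open import Data.Nat.Properties
open import Data.Integer using (ℤ; +_)
import Data.Integer.Properties as ℤP
open import Data.Fin using (Fin)
open import Data.List using (List; []; _∷_; length; filter; allFin)
open import Data.List.Relation.Unary.Any using (Any; here; there)
import Data.List.Relation.Unary.Any as Any
open import Data.List.Membership.Propositional using (_∈_)
open import Data.List.Membership.Propositional.Properties using (∈-allFin)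
open import Data.Product using (_×_; _,_; ∃; proj₁; proj₂)
open import Data.Sum using (inj₁; inj₂)
open import Level using (0ℓ)
open import Relation.Nullary using (¬?; yes; no; contradiction)
open import Relation.Unary using (Pred; Decidable; _⊆_; _∪_; _∩_; _∖_)
open import Relation.Unary.Properties using (_∪?_; _∩?_)
open import Relation.Binary.Core using (_Preserves_⟶_)
open import Relation.Binary.PropositionalEquality
  using (_≡_; _≢_; refl; sym; trans; cong; subst; module ≡-Reasoning)

count : ∀ {a p} {A : Set a} {P : Pred A p} → Decidable P → List A → ℕ
count P? xs = length (filter P? xs)

module _ {a p q} {A : Set a} {P : Pred A p} {Q : Pred A q}
         (P? : Decidable P) (Q? : Decidable Q) where

  count-mono : P ⊆ Q → ∀ xs → count P? xs ≤ count Q? xs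
  count-mono P⊆Q [] = z≤n
  count-mono P⊆Q (x ∷ xs) with P? x | Q? x
  ... | yes Px | no ¬Qx = contradiction (P⊆Q Px) ¬Qx
  ... | yes _  | yes _  = s≤s (count-mono P⊆Q xs)
  ... | no _   | yes _  = m≤n⇒m≤1+n (count-mono P⊆Q xs)
  ... | no _   | no _   = count-mono P⊆Q xs

  count-strictMono : P ⊆ Q → ∀ {xs} → Any (Q ∖ P) xs → count P? xs < count Q? xs
  count-strictMono P⊆Q {x ∷ xs} (here (Qx , ¬Px)) with P? x | Q? x
  ... | yes Px | _      = contradiction Px ¬Px
  ... | no _   | no ¬Qx = contradiction Qx ¬Qx
  ... | no _   | yes _  = s≤s (count-mono P⊆Q xs)
  count-strictMono P⊆Q {x ∷ xs} (there new) with P? x | Q? x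
  ... | yes Px | no ¬Qx = contradiction (P⊆Q Px) ¬Qx
  ... | yes _  | yes _  = s≤s (count-strictMono P⊆Q new)
  ... | no _   | yes _  = m<n⇒m<1+n (count-strictMono P⊆Q new)
  ... | no _   | no _   = count-strictMono P⊆Q new

  count-∪ : ∀ xs → count (P? ∪? Q?) xs ≤ count P? xs + count Q? xs
  count-∪ [] = z≤n
  count-∪ (x ∷ xs) with P? x | Q? x
  ... | yes _ | yes _ = s≤s (≤-trans (count-∪ xs) (+-monoʳ-≤ (count P? xs) (n≤1+n _)))
  ... | yes _ | no _  = s≤s (count-∪ xs)
  ... | no _  | yes _ = ≤-trans (s≤s (count-∪ xs)) (≤-reflexive (sym (+-suc _ _)))
  ... | no _  | no _  = count-∪ xs

module _ {a q} {A : Set a} {Q : Pred A q} (Q? : Decidable Q) (h : A → ℕ) where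

  count-distinctLevels : (e : ℕ → ℕ) → e Preserves _<_ ⟶ _<_ → ∀ {xs} m →
    (∀ j → j < m → ∃ λ w → w ∈ xs × Q w × h w ≡ e j) → m ≤ count Q? xs
  count-distinctLevels e e-mono {xs} m hit =
    ≤-trans (countBelow m e-mono hit) (count-mono (below? _) Q? proj₁ xs)
    where
    Below : ℕ → Pred A _
    Below b = Q ∩ λ w → h w < b

    below? : ∀ b → Decidable (Below b)
    below? b = Q? ∩? λ w → h w <? b

    countBelow : ∀ {b} m → (∀ {j} → j < m → e j < b) →
      (∀ j → j < m → ∃ λ w → w ∈ xs × Q w × h w ≡ e j) → m ≤ count (below? b) xs
    countBelow zero _ _ = z≤n
    countBelow {b} (suc m) e<b hit with hit m ≤-refl
    ... | w , w∈xs , Qw , hw≡em = begin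
      suc m                         ≤⟨ s≤s (countBelow m e-mono (λ j j<m → hit j (m<n⇒m<1+n j<m))) ⟩
      suc (count (below? (e m)) xs) ≤⟨ count-strictMono (below? (e m)) (below? b) raise wAtLevel ⟩
      count (below? b) xs           ∎
      where
      open ≤-Reasoning
      em<b : e m < b
      em<b = e<b ≤-refl

      raise : Below (e m) ⊆ Below b
      raise (Qx , hx<em) = Qx , <-trans hx<em em<b

      wAtLevel : Any (Below b ∖ Below (e m)) xs
      wAtLevel = Any.map (λ { refl → (Qw , subst (_< b) (sym hw≡em) em<b)
                                   , λ (_ , hw<em) → <-irrefl hw≡em hw<em }) w∈xs

+-≤-tight : ∀ {a b i j} → a ≤ i → b ≤ j → i + j ≤ a + b → a ≡ i × b ≡ j
+-≤-tight {a} {b} {i} {j} a≤i b≤j i+j≤a+b =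
  ≤-antisym a≤i (+-cancelʳ-≤ j i a (≤-trans i+j≤a+b (+-monoʳ-≤ a b≤j))) ,
  ≤-antisym b≤j (+-cancelˡ-≤ i j b (≤-trans i+j≤a+b (+-monoˡ-≤ b a≤i)))

module _ {n} {G : Graph n} where

  _++ʷ_ : ∀ {u w v i j} → Walk G u w i → Walk G w v j → Walk G u v (i + j)
  here     ++ʷ q = q
  step a p ++ʷ q = step a (p ++ʷ q)

  snocʷ : ∀ {u w v k} → Walk G u w k → Adj G w v → Walk G u v (suc k)
  snocʷ here       a = step a here
  snocʷ (step b p) a = step b (snocʷ p a)

  reverseʷ : ∀ {u v k} → Walk G u v k → Walk G v u k
  reverseʷ here       = here
  reverseʷ (step a p) = snocʷ (reverseʷ p) (adj-sym G a)

  splitAtʷ : ∀ {u v k i} → i ≤ k → Walk G u v k → ∃ λ x → Walk G u x i × Walk G x v (k ∸ i)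
  splitAtʷ z≤n       p          = _ , here , p
  splitAtʷ (s≤s i≤k) (step a p) with splitAtʷ i≤k p
  ... | x , q , r = x , step a q , r

module _ {n} (d : Fin n → Fin n → ℕ) (f : Fin n → ℤ) where

  Misfit : Fin n → Pred (Fin n) 0ℓ
  Misfit x w = + d w x ≢ f w

  misfit? : ∀ x → Decidable (Misfit x)
  misfit? x w = ¬? (+ d w x ℤP.≟ f w)

  misfit-of-≢ : ∀ {u v w} → d w u ≢ d w v → (Misfit u ∪ Misfit v) w
  misfit-of-≢ {u} {v} {w} d≢d with + d w u ℤP.≟ f w | + d w v ℤP.≟ f w
  ... | no fu≢  | _       = inj₁ fu≢
  ... | yes _   | no fv≢  = inj₂ fv≢
  ... | yes fu≡ | yes fv≡ = contradiction (ℤP.+-injective (trans fu≡ (sym fv≡))) d≢d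

module ShortestPath {n} {G : Graph n} {d : Fin n → Fin n → ℕ}
                    (isDist : IsShortestPathDistance G d) where

  geodesic : ∀ u v → Walk G u v (d u v)
  geodesic u v = proj₁ (isDist u v)

  minimal : ∀ {u v k} → Walk G u v k → d u v ≤ k
  minimal {u} {v} = proj₂ (isDist u v) _

  d-sym : ∀ u v → d u v ≡ d v u
  d-sym u v = ≤-antisym (minimal (reverseʷ (geodesic v u))) (minimal (reverseʷ (geodesic u v)))

  d-triangle : ∀ u x v → d u v ≤ d u x + d x v
  d-triangle u x v = minimal (geodesic u x ++ʷ geodesic x v)

  geodesic-point : ∀ u v {i} → i ≤ d u v → ∃ λ x → d u x ≡ i × d x v ≡ d u v ∸ i
  geodesic-point u v {i} i≤d with splitAtʷ i≤d (geodesic u v)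
  ... | x , p , q = x , +-≤-tight (minimal p) (minimal q) (begin
        i + (d u v ∸ i) ≡⟨ m+[n∸m]≡n i≤d ⟩
        d u v           ≤⟨ d-triangle u x v ⟩
        d u x + d x v   ∎)
    where open ≤-Reasoning

  misfit-on-geodesic : ∀ f u v {i} → i ≤ d u v → i + i ≢ d u v →
    ∃ λ x → (Misfit d f u ∪ Misfit d f v) x × d x u ≡ i
  misfit-on-geodesic f u v {i} i≤d 2i≢d with geodesic-point u v i≤d
  ... | x , dux≡i , dxv≡d∸i = x , misfit-of-≢ d f notMidpoint , trans (d-sym x u) dux≡i
    where
    notMidpoint : d x u ≢ d x v
    notMidpoint dxu≡dxv = 2i≢d (begin
      i + i           ≡⟨ cong (λ m → i + m) (trans (sym dux≡i) (trans (d-sym u x) (trans dxu≡dxv dxv≡d∸i))) ⟩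
      i + (d u v ∸ i) ≡⟨ m+[n∸m]≡n i≤d ⟩
      d u v           ∎)
      where open ≡-Reasoning

-- The levels 0, 1, 2, … with ⌈k/2⌉ left out, so that none of them is k/2.
skipMidpoint : ℕ → ℕ → ℕ
skipMidpoint k j with k ≤? j + j
... | yes _ = suc j
... | no _  = j

skipMidpoint-strictMono : ∀ k → skipMidpoint k Preserves _<_ ⟶ _<_
skipMidpoint-strictMono k {i} {j} i<j with k ≤? i + i | k ≤? j + j
... | yes _    | yes _    = s≤s i<j
... | no _     | no _     = i<j
... | no _     | yes _    = m<n⇒m<1+n i<j
... | yes k≤2i | no k≰2j  = contradiction (≤-trans k≤2i (+-mono-≤ (<⇒≤ i<j) (<⇒≤ i<j))) k≰2j

skipMidpoint-≤ : ∀ {k j} → j < k → skipMidpoint k j ≤ k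
skipMidpoint-≤ {k} {j} j<k with k ≤? j + j
... | yes _ = j<k
... | no _  = <⇒≤ j<k

skipMidpoint-double≢ : ∀ k j → skipMidpoint k j + skipMidpoint k j ≢ k
skipMidpoint-double≢ k j with k ≤? j + j
... | yes k≤2j = λ eq → <-irrefl (sym eq) (s≤s (≤-trans k≤2j (+-monoʳ-≤ j (n≤1+n j))))
... | no k≰2j  = λ eq → <-irrefl eq (≰⇒> k≰2j)

mainTheorem7 : ∀ (n : ℕ) (G : Graph n) → Connected G →
    (d : Fin n → Fin n → ℕ) → IsShortestPathDistance G d →
    (f : Fin n → ℤ) →
    ∀ (u v : Fin n) → d u v ≤ φ d f u + φ d f v
mainTheorem7 n G _ d isDist f u v = begin
  d u v                      ≤⟨ count-distinctLevels misfit?ᵤᵥ (λ w → d w u) (skipMidpoint (d u v))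
                                  (skipMidpoint-strictMono (d u v)) (d u v) misfitAtLevel ⟩
  count misfit?ᵤᵥ (allFin n) ≤⟨ count-∪ (misfit? d f u) (misfit? d f v) (allFin n) ⟩
  φ d f u + φ d f v          ∎
  where
  open ≤-Reasoning
  open ShortestPath isDist

  misfit?ᵤᵥ : Decidable (Misfit d f u ∪ Misfit d f v)
  misfit?ᵤᵥ = misfit? d f u ∪? misfit? d f v

  misfitAtLevel : ∀ j → j < d u v →
    ∃ λ w → w ∈ allFin n × (Misfit d f u ∪ Misfit d f v) w × d w u ≡ skipMidpoint (d u v) j
  misfitAtLevel j j<d with misfit-on-geodesic f u v (skipMidpoint-≤ j<d) (skipMidpoint-double≢ (d u v) j)
  ... | x , misfit , level = x , ∈-allFin x , misfit , level
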